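{- Let $i,j,\ell$ be integers with $1\leq i\leq j\leq\ell$. Suppose that $\mathcal{F}\subset\binom{[n]}{\ell}$ is intersecting and $\tau(\mathcal{F})\geq j$. Then \[ \Delta_i(\mathcal{F})\leq \ell^{\,j-i}\,\Delta_j(\mathcal{F}). \]
   Context: A family is intersecting if any two members intersect. $\tau(\mathcal{F})$ is the minimum size of a set meeting every member of $\mathcal{F}$. For $S\subset[n]$, $\mathcal{F}(S)=\{F\setminus S:S\subset F\in\mathcal{F}\}$, and $\Delta_i(\mathcal{F})=\max_{S\in\binom{[n]}{i}}|\mathcal{F}(S)|$. -}

module Defs where

open import Data.Nat using (ℕ; zero; suc; _⊔_; _⊓_)
open import Data.Nat.Properties using (_≟_)
open import Data.List using (List; []; _∷_; [_]; map; _++_; filter; foldr; length)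
open import Data.List.Relation.Unary.All using (All; all?)
open import Data.List.Membership.Propositional using (_∈_)
open import Data.Fin.Subset using (Subset; outside; inside; _∩_; _─_; ∣_∣; Nonempty)
open import Data.Fin.Subset.Properties using (_⊆?_; nonempty?)
open import Data.Vec using ([]; _∷_)
open import Relation.Binary.PropositionalEquality using (_≡_)

allSubsets : (n : ℕ) → List (Subset n)
allSubsets zero    = [ [] ]
allSubsets (suc n) = map (outside ∷_) (allSubsets n) ++ map (inside ∷_) (allSubsets n)

-- A family of subsets of [n] is a duplicate-free list (Unique is imposed in the statement).
-- F ⊆ binom([n], ℓ): every member has size ℓ.
Uniform : {n : ℕ} → ℕ → List (Subset n) → Set
Uniform ℓ F = All (λ A → ∣ A ∣ ≡ ℓ) F

Intersecting : {n : ℕ} → List (Subset n) → Set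
Intersecting F = ∀ {A B} → A ∈ F → B ∈ F → Nonempty (A ∩ B)

Transversal : {n : ℕ} → List (Subset n) → Subset n → Set
Transversal F T = All (λ A → Nonempty (T ∩ A)) F

-- τ(F): minimum size of a transversal (default n if none exists, which cannot
-- happen when all members are nonempty, since [n] is then a transversal).
τ : {n : ℕ} → List (Subset n) → ℕ
τ {n} F = foldr (λ T m → ∣ T ∣ ⊓ m) n
            (filter (λ T → all? (λ A → nonempty? (T ∩ A)) F) (allSubsets n))

link : {n : ℕ} → List (Subset n) → Subset n → List (Subset n)
link F S = map (λ A → A ─ S) (filter (S ⊆?_) F)

Δ : {n : ℕ} → ℕ → List (Subset n) → ℕ
Δ {n} i F = foldr _⊔_ 0
              (map (λ S → length (link F S)) (filter (λ S → ∣ S ∣ ≟ i) (allSubsets n)))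

{-# OPTIONS --safe #-}
module Submission where

-- Let S be a set of size i < τ(F). Then S is not a transversal, so some A₀ ∈ F
-- misses S. Every member of F containing S meets A₀ in some x, hence contains
-- S ∪ {x}, a set of size i + 1; summing over the ℓ points x of A₀ gives
-- Δᵢ(F) ≤ ℓ Δᵢ₊₁(F). Iterating this from i up to j ≤ τ(F) proves the claim.

open import Defs
open import Data.Nat using (ℕ; _≤_; _<_; _*_; _^_; _∸_; _+_; _⊔_; _⊓_; suc; z≤n; s≤s)
open import Data.Nat.Properties
open import Data.Nat.ListAction using (sum)
open import Data.List using (List; []; _∷_; map; filter; foldr; length)
open import Data.List.Properties using (length-map; foldr-preservesᵇ; filter-accept)
open import Data.List.Relation.Unary.All using (All; all?)
import Data.List.Relation.Unary.All as All
open import Data.List.Relation.Unary.All.Properties using (all-filter; ¬All⇒Any¬; map⁺)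
open import Data.List.Relation.Unary.Any using (Any; here; there)
import Data.List.Relation.Unary.Any as Any
open import Data.List.Relation.Unary.Unique.Propositional using (Unique)
open import Data.List.Membership.Propositional using (find) renaming (_∈_ to _∈ₗ_)
open import Data.List.Membership.Propositional.Properties
  using (∈-map⁺; ∈-map⁻; ∈-++⁺ˡ; ∈-++⁺ʳ; ∈-filter⁺)
open import Data.Fin using (Fin)
import Data.Fin as Fin
open import Data.Fin.Subset
  using (Subset; outside; inside; _∩_; _∪_; _─_; ∣_∣; Nonempty; _∈_; _∉_; _⊆_; ⁅_⁆)
open import Data.Fin.Subset.Properties
  using (_⊆?_; nonempty?; x∈p∩q⁺; x∈p∩q⁻; x∈p∪q⁻; x∈⁅y⁆⇒x≡y; ∪-identityʳ)
open import Data.Vec using ([]; _∷_; here; there)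
open import Data.Product using (∃-syntax; _×_; _,_)
open import Data.Sum using (inj₁; inj₂)
open import Function using (_∘_)
open import Level using (Level)
open import Relation.Nullary using (¬_; yes; no; contradiction)
open import Relation.Unary using (Pred; Decidable)
open import Relation.Binary.PropositionalEquality
  using (_≡_; refl; sym; trans; cong; subst)

private
  variable
    a b : Level
    A : Set a
    B : Set b

∈⇒≤-foldr-⊔ : ∀ {m ms} → m ∈ₗ ms → m ≤ foldr _⊔_ 0 ms
∈⇒≤-foldr-⊔ (here refl) = m≤m⊔n _ _
∈⇒≤-foldr-⊔ (there m∈) = ≤-trans (∈⇒≤-foldr-⊔ m∈) (m≤n⊔m _ _)

foldr-⊔-lub : ∀ {M ms} → All (_≤ M) ms → foldr _⊔_ 0 ms ≤ M
foldr-⊔-lub = foldr-preservesᵇ ⊔-lub z≤n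

foldr-⊓-≤ : (g : A → ℕ) (e : ℕ) {x : A} {xs : List A} → x ∈ₗ xs →
            foldr (λ y m → g y ⊓ m) e xs ≤ g x
foldr-⊓-≤ g e (here refl) = m⊓n≤m _ _
foldr-⊓-≤ g e (there x∈) = ≤-trans (m⊓n≤n _ _) (foldr-⊓-≤ g e x∈)

sum-map-mono : {f g : B → ℕ} → (∀ y → f y ≤ g y) → (ys : List B) →
               sum (map f ys) ≤ sum (map g ys)
sum-map-mono f≤g []       = z≤n
sum-map-mono f≤g (y ∷ ys) = +-mono-≤ (f≤g y) (sum-map-mono f≤g ys)

sum-map-< : {f g : B → ℕ} → (∀ y → f y ≤ g y) → ∀ {y₀ ys} → y₀ ∈ₗ ys → f y₀ < g y₀ →
            sum (map f ys) < sum (map g ys)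
sum-map-< f≤g {ys = _ ∷ ys} (here refl) f<g = +-mono-<-≤ f<g (sum-map-mono f≤g ys)
sum-map-< f≤g {ys = y ∷ _} (there y₀∈) f<g = +-mono-≤-< (f≤g y) (sum-map-< f≤g y₀∈ f<g)

sum-map-≤-* : (f : B → ℕ) (M : ℕ) (ys : List B) → (∀ {y} → y ∈ₗ ys → f y ≤ M) →
              sum (map f ys) ≤ length ys * M
sum-map-≤-* f M []       bound = z≤n
sum-map-≤-* f M (y ∷ ys) bound = +-mono-≤ (bound (here refl)) (sum-map-≤-* f M ys (bound ∘ there))

count : ∀ {r} {P : Pred A r} → Decidable P → List A → ℕ
count P? xs = length (filter P? xs)

count-accept : ∀ {r} {P : Pred A r} (P? : Decidable P) {x : A} {xs : List A} → P x →
               count P? (x ∷ xs) ≡ suc (count P? xs)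
count-accept P? px = cong length (filter-accept P? px)

count-≤-∷ : ∀ {r} {P : Pred A r} (P? : Decidable P) (x : A) (xs : List A) →
            count P? xs ≤ count P? (x ∷ xs)
count-≤-∷ P? x xs with P? x
... | yes _ = n≤1+n _
... | no _  = ≤-refl

count-≤-sum-count : ∀ {p q} {P : Pred A p} {Q : B → Pred A q}
  (P? : Decidable P) (Q? : ∀ y → Decidable (Q y)) (ys : List B) (xs : List A) → (∀ {x} → x ∈ₗ xs → P x → Any (λ y → Q y x) ys) →
  count P? xs ≤ sum (map (λ y → count (Q? y) xs) ys)
count-≤-sum-count P? Q? ys []       covered = z≤n
count-≤-sum-count P? Q? ys (x ∷ xs) covered with P? x
... | no _  = ≤-trans (count-≤-sum-count P? Q? ys xs (covered ∘ there))
                      (sum-map-mono (λ y → count-≤-∷ (Q? y) x xs) ys)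
... | yes px with find (covered (here refl) px)
...   | y , y∈ , qyx = <-≤-trans (s≤s (count-≤-sum-count P? Q? ys xs (covered ∘ there)))
          (sum-map-< (λ y → count-≤-∷ (Q? y) x xs) y∈ (≤-reflexive (sym (count-accept (Q? y) qyx))))

∈-allSubsets : {n : ℕ} (S : Subset n) → S ∈ₗ allSubsets n
∈-allSubsets []                = here refl
∈-allSubsets (outside ∷ S)     = ∈-++⁺ˡ (∈-map⁺ (outside ∷_) (∈-allSubsets S))
∈-allSubsets {suc n} (inside ∷ S) =
  ∈-++⁺ʳ (map (outside ∷_) (allSubsets n)) (∈-map⁺ (inside ∷_) (∈-allSubsets S))

elements : {n : ℕ} → Subset n → List (Fin n)
elements []            = []
elements (outside ∷ p) = map Fin.suc (elements p)
elements (inside ∷ p)  = Fin.zero ∷ map Fin.suc (elements p)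

length-elements : {n : ℕ} (p : Subset n) → length (elements p) ≡ ∣ p ∣
length-elements []            = refl
length-elements (outside ∷ p) = trans (length-map Fin.suc (elements p)) (length-elements p)
length-elements (inside ∷ p)  = cong suc (trans (length-map Fin.suc (elements p)) (length-elements p))

∈-elements⁺ : {n : ℕ} (p : Subset n) {x : Fin n} → x ∈ p → x ∈ₗ elements p
∈-elements⁺ (inside ∷ p)  here       = here refl
∈-elements⁺ (outside ∷ p) (there x∈) = ∈-map⁺ Fin.suc (∈-elements⁺ p x∈)
∈-elements⁺ (inside ∷ p)  (there x∈) = there (∈-map⁺ Fin.suc (∈-elements⁺ p x∈))

∈-elements⁻ : {n : ℕ} (p : Subset n) {x : Fin n} → x ∈ₗ elements p → x ∈ p
∈-elements⁻ (outside ∷ p) x∈ with ∈-map⁻ Fin.suc x∈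
... | _ , y∈ , refl = there (∈-elements⁻ p y∈)
∈-elements⁻ (inside ∷ p) (here refl) = here
∈-elements⁻ (inside ∷ p) (there x∈) with ∈-map⁻ Fin.suc x∈
... | _ , y∈ , refl = there (∈-elements⁻ p y∈)

∣p∪⁅x⁆∣≡1+∣p∣ : {n : ℕ} (p : Subset n) {x : Fin n} → x ∉ p → ∣ p ∪ ⁅ x ⁆ ∣ ≡ suc ∣ p ∣
∣p∪⁅x⁆∣≡1+∣p∣ (outside ∷ p) {Fin.zero}  x∉ = cong (suc ∘ ∣_∣) (∪-identityʳ p)
∣p∪⁅x⁆∣≡1+∣p∣ (inside ∷ p)  {Fin.zero}  x∉ = contradiction here x∉
∣p∪⁅x⁆∣≡1+∣p∣ (outside ∷ p) {Fin.suc x} x∉ = ∣p∪⁅x⁆∣≡1+∣p∣ p (x∉ ∘ there)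
∣p∪⁅x⁆∣≡1+∣p∣ (inside ∷ p)  {Fin.suc x} x∉ = cong suc (∣p∪⁅x⁆∣≡1+∣p∣ p (x∉ ∘ there))

p∪⁅x⁆⊆q : {n : ℕ} {p q : Subset n} {x : Fin n} → p ⊆ q → x ∈ q → p ∪ ⁅ x ⁆ ⊆ q
p∪⁅x⁆⊆q {p = p} {q} {x} p⊆q x∈q y∈ with x∈p∪q⁻ p ⁅ x ⁆ y∈
... | inj₁ y∈p = p⊆q y∈p
... | inj₂ y∈x = subst (_∈ q) (sym (x∈⁅y⁆⇒x≡y x y∈x)) x∈q

module _ {n : ℕ} (F : List (Subset n)) where

  length-link : (S : Subset n) → length (link F S) ≡ count (S ⊆?_) F
  length-link S = length-map (λ A → A ─ S) (filter (S ⊆?_) F)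

  count-≤-Δ : (k : ℕ) (S : Subset n) → ∣ S ∣ ≡ k → count (S ⊆?_) F ≤ Δ k F
  count-≤-Δ k S ∣S∣≡k = subst (_≤ Δ k F) (length-link S)
    (∈⇒≤-foldr-⊔ (∈-map⁺ (length ∘ link F) (∈-filter⁺ (λ T → ∣ T ∣ ≟ k) (∈-allSubsets S) ∣S∣≡k)))

  Δ-lub : (k M : ℕ) → (∀ S → ∣ S ∣ ≡ k → count (S ⊆?_) F ≤ M) → Δ k F ≤ M
  Δ-lub k M bound = foldr-⊔-lub (map⁺ (All.map
    (λ {S} ∣S∣≡k → subst (_≤ M) (sym (length-link S)) (bound S ∣S∣≡k))
    (all-filter (λ T → ∣ T ∣ ≟ k) (allSubsets n))))

  τ-≤-transversal : (T : Subset n) → Transversal F T → τ F ≤ ∣ T ∣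
  τ-≤-transversal T tr =
    foldr-⊓-≤ ∣_∣ n (∈-filter⁺ (λ T → all? (λ A → nonempty? (T ∩ A)) F) (∈-allSubsets T) tr)

  <τ⇒missed-member : (S : Subset n) → ∣ S ∣ < τ F → ∃[ A ] A ∈ₗ F × ¬ Nonempty (S ∩ A)
  <τ⇒missed-member S ∣S∣<τ = find (¬All⇒Any¬ (λ A → nonempty? (S ∩ A)) F
    (λ tr → <⇒≱ ∣S∣<τ (τ-≤-transversal S tr)))

module _ {n ℓ : ℕ} (F : List (Subset n)) (uniform : Uniform ℓ F) (intersecting : Intersecting F) where

  Δ-≤-ℓ*Δ-suc : (i : ℕ) → i < τ F → Δ i F ≤ ℓ * Δ (suc i) F
  Δ-≤-ℓ*Δ-suc i i<τ = Δ-lub F i (ℓ * Δ (suc i) F) bound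
    where
    bound : ∀ S → ∣ S ∣ ≡ i → count (S ⊆?_) F ≤ ℓ * Δ (suc i) F
    bound S ∣S∣≡i with <τ⇒missed-member F S (subst (_< τ F) (sym ∣S∣≡i) i<τ)
    ... | A₀ , A₀∈F , S∩A₀=∅ = begin
      count (S ⊆?_) F
        ≤⟨ count-≤-sum-count (S ⊆?_) (λ x → (S ∪ ⁅ x ⁆) ⊆?_) (elements A₀) F covered ⟩
      sum (map (λ x → count ((S ∪ ⁅ x ⁆) ⊆?_) F) (elements A₀))
        ≤⟨ sum-map-≤-* _ _ (elements A₀) (λ x∈ → count-≤-Δ F (suc i) _ (∣S∪⁅x⁆∣ (∈-elements⁻ A₀ x∈))) ⟩
      length (elements A₀) * Δ (suc i) F
        ≡⟨ cong (_* Δ (suc i) F) (trans (length-elements A₀) (All.lookup uniform A₀∈F)) ⟩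
      ℓ * Δ (suc i) F ∎
      where
      open ≤-Reasoning
      ∣S∪⁅x⁆∣ : ∀ {x} → x ∈ A₀ → ∣ S ∪ ⁅ x ⁆ ∣ ≡ suc i
      ∣S∪⁅x⁆∣ x∈A₀ = trans (∣p∪⁅x⁆∣≡1+∣p∣ S (λ x∈S → S∩A₀=∅ (_ , x∈p∩q⁺ (x∈S , x∈A₀))))
                           (cong suc ∣S∣≡i)
      covered : ∀ {A} → A ∈ₗ F → S ⊆ A → Any (λ x → S ∪ ⁅ x ⁆ ⊆ A) (elements A₀)
      covered {A} A∈F S⊆A with intersecting A∈F A₀∈F
      ... | x , x∈A∩A₀ with x∈p∩q⁻ A A₀ x∈A∩A₀
      ... | x∈A , x∈A₀ = Any.map (λ { refl {y} → p∪⁅x⁆⊆q S⊆A x∈A {y} }) (∈-elements⁺ A₀ x∈A₀)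

  Δ-≤-ℓ^k*Δ : (k i : ℕ) → i + k ≤ τ F → Δ i F ≤ ℓ ^ k * Δ (i + k) F
  Δ-≤-ℓ^k*Δ 0 i _ rewrite +-identityʳ i = ≤-reflexive (sym (+-identityʳ _))
  Δ-≤-ℓ^k*Δ (suc k) i i+1+k≤τ = begin
    Δ i F                         ≤⟨ Δ-≤-ℓ*Δ-suc i (<-≤-trans (s≤s (m≤m+n i k)) 1+i+k≤τ) ⟩
    ℓ * Δ (suc i) F               ≤⟨ *-monoʳ-≤ ℓ (Δ-≤-ℓ^k*Δ k (suc i) 1+i+k≤τ) ⟩
    ℓ * (ℓ ^ k * Δ (suc i + k) F) ≡⟨ sym (*-assoc ℓ _ _) ⟩
    ℓ ^ suc k * Δ (suc i + k) F   ≡⟨ cong (λ m → ℓ ^ suc k * Δ m F) (sym (+-suc i k)) ⟩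
    ℓ ^ suc k * Δ (i + suc k) F   ∎
    where
    open ≤-Reasoning
    1+i+k≤τ : suc i + k ≤ τ F
    1+i+k≤τ = subst (_≤ τ F) (+-suc i k) i+1+k≤τ

proposition5p2 : {n : ℕ} (i j ℓ : ℕ) → 1 ≤ i → i ≤ j → j ≤ ℓ →
    (F : List (Subset n)) → Unique F → Uniform ℓ F → Intersecting F → j ≤ τ F →
    Δ i F ≤ ℓ ^ (j ∸ i) * Δ j F
proposition5p2 i j ℓ _ i≤j _ F _ uniform intersecting j≤τ =
  subst (λ m → Δ i F ≤ ℓ ^ (j ∸ i) * Δ m F) i+[j∸i]≡j
    (Δ-≤-ℓ^k*Δ F uniform intersecting (j ∸ i) i (subst (_≤ τ F) (sym i+[j∸i]≡j) j≤τ))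
  where
  i+[j∸i]≡j : i + (j ∸ i) ≡ j
  i+[j∸i]≡j = m+[n∸m]≡n i≤j
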